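{- Consider $2\times2\times2$ arrays with entries in $\{0,1\}$ regarded as a Boolean algebra. The maximum rank of such an array is $4$, and the numbers of arrays of rank $0,1,2,3,4$ are $1,27,130,88,10$ respectively.
   Context: For $\{0,1\}$-vectors $V_1,V_2,V_3$ of length 2, the outer product $V_1\otimes V_2\otimes V_3$ has entries $v_{1i}v_{2j}v_{3k}$. The Boolean rank of a $\{0,1\}$-array $X$ is the least $R$ such that $X$ is the entrywise Boolean sum (with $1+1=1$, i.e. entrywise OR) of $R$ outer products of nonzero $\{0,1\}$-vectors; the zero array has rank $0$. -}

module Defs where

open import Data.Bool using (Bool; true; false; _∧_; _∨_)
open import Data.Fin using (Fin; zero; suc)
open import Data.Nat using (ℕ; _<_)
open import Data.List using (List; []; _∷_; concatMap; map)
open import Data.Vec using (Vec; foldr)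
open import Data.Product using (Σ; ∃; _×_)
open import Relation.Binary.PropositionalEquality using (_≡_)
open import Relation.Nullary using (¬_)

-- {0,1}-vectors of length 2 (1 = true, 0 = false)
BVec : Set
BVec = Fin 2 → Bool

NonZero : BVec → Set
NonZero v = ∃ λ i → v i ≡ true

Array : Set
Array = Fin 2 → Fin 2 → Fin 2 → Bool

_≋_ : Array → Array → Set
X ≋ Y = ∀ i j k → X i j k ≡ Y i j k

outer : BVec → BVec → BVec → Array
outer v₁ v₂ v₃ i j k = v₁ i ∧ (v₂ j ∧ v₃ k)

zeroArray : Array
zeroArray i j k = false

_⊕_ : Array → Array → Array
(X ⊕ Y) i j k = X i j k ∨ Y i j k

record Term : Set where
  constructor term
  field
    v₁ v₂ v₃ : BVec
    nz₁ : NonZero v₁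
    nz₂ : NonZero v₂
    nz₃ : NonZero v₃

termArray : Term → Array
termArray (term a b c _ _ _) = outer a b c

sumTerms : ∀ {R} → Vec Term R → Array
sumTerms = foldr _ (λ t acc → termArray t ⊕ acc) zeroArray

Representable : Array → ℕ → Set
Representable X R = Σ (Vec Term R) λ ts → sumTerms ts ≋ X

HasRank : Array → ℕ → Set
HasRank X R = Representable X R × (∀ R' → R' < R → ¬ Representable X R')

pair : {A : Set} → A → A → Fin 2 → A
pair a b zero = a
pair a b (suc zero) = b

funs2 : {A : Set} → List A → List (Fin 2 → A)
funs2 xs = concatMap (λ a → map (pair a) xs) xs

-- the list of all 256 arrays, each exactly once
allArrays : List Array
allArrays = funs2 (funs2 (funs2 (true ∷ false ∷ [])))

module Submission where

-- Every array X is the union of its four lines in the third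
-- direction, X = ⋁ᵢⱼ eᵢ ⊗ eⱼ ⊗ X[i,j,·], and each line is a single outer
-- product or zero; so every array is a Boolean sum of at most 4 terms.
--
-- The nonzero vectors of length 2 are exactly 10, 01
-- and 11, so every outer product agrees entrywise with one of 27 canonical
-- rank-one arrays, and every summand of a Boolean sum lies entrywise below
-- the sum.  Hence X is a sum of n outer products iff n canonical rank-one
-- arrays below X sum to X, which is a finite search ('Completes').
--
-- The rank of X is the least n ≤ 4 found by this search (the library's
-- least-counterexample search on Fin 5); the array of rank 4 and the five
-- counts are then checked by evaluation.

open import Defs
open import Data.Nat using (ℕ; _≤_; _≟_)
open import Data.List using (length; filter)
open import Data.Product using (Σ; ∃; _×_)
open import Relation.Binary.PropositionalEquality using (_≡_)

open import Data.Bool using (true; false; _∧_; _∨_)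
import Data.Bool as Bool
import Data.Bool.Properties as Bool
open import Data.Fin using (Fin; zero; suc; toℕ; fromℕ<; Fin′; inject; inject₁)
open import Data.Fin.Patterns using (0F; 1F)
open import Data.Fin.Properties using (all?; any?; ¬∀⟶∃¬-smallest; toℕ<n; toℕ-inject; toℕ-fromℕ<)
open import Data.List using (List; allFin; cartesianProduct)
open import Data.List.Membership.Propositional using (_∈_)
open import Data.List.Membership.Propositional.Properties using (∈-allFin; ∈-cartesianProduct⁺; ∈-filter⁺)
open import Data.List.Relation.Unary.Any as Any using (Any)
open import Data.Nat using (zero; suc; _+_; _<_; z≤n; s≤s; s≤s⁻¹)
open import Data.Nat.Properties using (≤-refl; +-mono-≤)
open import Data.Product using (_,_; proj₁)
open import Data.Vec using (Vec; []; _∷_; _++_)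
open import Relation.Binary.PropositionalEquality using (refl; sym; trans; cong; cong₂; subst)
open import Relation.Nullary using (Dec; yes; no; ¬_; contradiction)
open import Relation.Nullary.Decidable using (map′; ¬?; decidable-stable)

_⊑_ : Array → Array → Set
X ⊑ Y = ∀ i j k → X i j k Bool.≤ Y i j k

_⊑?_ : (X Y : Array) → Dec (X ⊑ Y)
X ⊑? Y = all? λ i → all? λ j → all? λ k → X i j k Bool.≤? Y i j k

_≋?_ : (X Y : Array) → Dec (X ≋ Y)
X ≋? Y = all? λ i → all? λ j → all? λ k → X i j k Bool.≟ Y i j k

≋-trans : ∀ {X Y Z} → X ≋ Y → Y ≋ Z → X ≋ Z
≋-trans p q i j k = trans (p i j k) (q i j k)

⊕-assoc : ∀ X Y Z → (X ⊕ (Y ⊕ Z)) ≋ ((X ⊕ Y) ⊕ Z)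
⊕-assoc X Y Z i j k = sym (Bool.∨-assoc (X i j k) (Y i j k) (Z i j k))

-- A summand lies below the Boolean sum; this justifies pruning the search.
summand-⊑ : ∀ X Y Z → Y ⊑ (X ⊕ (Y ⊕ Z))
summand-⊑ X Y Z i j k = below (X i j k) (Y i j k) (Z i j k)
  where
  below : ∀ x y z → y Bool.≤ x ∨ (y ∨ z)
  below true  y     z = Bool.≤-maximum y
  below false true  z = Bool.≤-refl
  below false false z = Bool.≤-minimum z

sumTerms-++ : ∀ {m n} (ts : Vec Term m) (us : Vec Term n) →
              sumTerms (ts ++ us) ≋ (sumTerms ts ⊕ sumTerms us)
sumTerms-++ []       us i j k = refl
sumTerms-++ (t ∷ ts) us i j k =
  trans (cong (termArray t i j k ∨_) (sumTerms-++ ts us i j k))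
        (⊕-assoc (termArray t) (sumTerms ts) (sumTerms us) i j k)

representable-≋ : ∀ {X Y n} → X ≋ Y → Representable X n → Representable Y n
representable-≋ X≋Y (ts , sum≋X) = ts , ≋-trans sum≋X X≋Y

RepresentableWithin : Array → ℕ → Set
RepresentableWithin X b = ∃ λ n → n ≤ b × Representable X n

within-≋ : ∀ {X Y b} → X ≋ Y → RepresentableWithin X b → RepresentableWithin Y b
within-≋ X≋Y (n , n≤b , r) = n , n≤b , representable-≋ X≋Y r

within-⊕ : ∀ {X Y a b} → RepresentableWithin X a → RepresentableWithin Y b →
           RepresentableWithin (X ⊕ Y) (a + b)
within-⊕ (m , m≤a , ts , sum≋X) (n , n≤b , us , sum≋Y) =
  m + n , +-mono-≤ m≤a n≤b , ts ++ us ,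
  λ i j k → trans (sumTerms-++ ts us i j k) (cong₂ _∨_ (sum≋X i j k) (sum≋Y i j k))

basis : Fin 3 → BVec
basis 0F       = pair true false
basis 1F       = pair false true
basis (suc 1F) = pair true true

basis-nonzero : ∀ k → NonZero (basis k)
basis-nonzero 0F       = 0F , refl
basis-nonzero 1F       = 1F , refl
basis-nonzero (suc 1F) = 0F , refl

basis-complete : ∀ v → NonZero v → ∃ λ k → ∀ i → v i ≡ basis k i
basis-complete v nz with v 0F in e₀ | v 1F in e₁
... | true  | false = 0F , λ { 0F → e₀ ; 1F → e₁ }
... | false | true  = 1F , λ { 0F → e₀ ; 1F → e₁ }
... | true  | true  = suc 1F , λ { 0F → e₀ ; 1F → e₁ }
... | false | false = contradiction nz zero-vector
  where
  zero-vector : ¬ NonZero v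
  zero-vector (0F , e) = Bool.not-¬ e₀ e
  zero-vector (1F , e) = Bool.not-¬ e₁ e

unit : Fin 2 → BVec
unit i = basis (inject₁ i)

outer-within-1 : ∀ v₁ v₂ v₃ → NonZero v₁ → NonZero v₂ → RepresentableWithin (outer v₁ v₂ v₃) 1
outer-within-1 v₁ v₂ v₃ nz₁ nz₂ with any? (λ k → v₃ k Bool.≟ true)
... | yes nz₃ = 1 , ≤-refl , term v₁ v₂ v₃ nz₁ nz₂ nz₃ ∷ [] , λ i j k → Bool.∨-identityʳ _
... | no ¬nz₃ = 0 , z≤n , [] , λ i j k → sym (vanishes i j k)
  where
  vanishes : ∀ i j k → outer v₁ v₂ v₃ i j k ≡ false
  vanishes i j k rewrite Bool.¬-not (λ e → ¬nz₃ (k , e)) =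
    trans (cong (v₁ i ∧_) (Bool.∧-zeroʳ (v₂ j))) (Bool.∧-zeroʳ (v₁ i))

lineArray : Array → Fin 2 → Fin 2 → Array
lineArray X i j = outer (unit i) (unit j) (λ k → X i j k)

lines-decomposition : ∀ X →
  (lineArray X 0F 0F ⊕ (lineArray X 0F 1F ⊕ (lineArray X 1F 0F ⊕ lineArray X 1F 1F))) ≋ X
lines-decomposition X 0F 0F k = Bool.∨-identityʳ (X 0F 0F k)
lines-decomposition X 0F 1F k = Bool.∨-identityʳ (X 0F 1F k)
lines-decomposition X 1F 0F k = Bool.∨-identityʳ (X 1F 0F k)
lines-decomposition X 1F 1F k = refl

representable-within-4 : ∀ X → RepresentableWithin X 4
representable-within-4 X =
  within-≋ (lines-decomposition X)
           (within-⊕ (line 0F 0F) (within-⊕ (line 0F 1F) (within-⊕ (line 1F 0F) (line 1F 1F))))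
  where
  line : ∀ i j → RepresentableWithin (lineArray X i j) 1
  line i j = outer-within-1 (unit i) (unit j) _ (basis-nonzero (inject₁ i)) (basis-nonzero (inject₁ j))

Shape : Set
Shape = Fin 3 × Fin 3 × Fin 3

shapeTerm : Shape → Term
shapeTerm (k₁ , k₂ , k₃) = term (basis k₁) (basis k₂) (basis k₃)
                                (basis-nonzero k₁) (basis-nonzero k₂) (basis-nonzero k₃)

shapeArray : Shape → Array
shapeArray s = termArray (shapeTerm s)

shapes : List Shape
shapes = cartesianProduct (allFin 3) (cartesianProduct (allFin 3) (allFin 3))

∈-shapes : ∀ s → s ∈ shapes
∈-shapes (k₁ , k₂ , k₃) =
  ∈-cartesianProduct⁺ (∈-allFin k₁) (∈-cartesianProduct⁺ (∈-allFin k₂) (∈-allFin k₃))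

term-canonical : ∀ t → ∃ λ s → termArray t ≋ shapeArray s
term-canonical (term v₁ v₂ v₃ nz₁ nz₂ nz₃)
  with basis-complete v₁ nz₁ | basis-complete v₂ nz₂ | basis-complete v₃ nz₃
... | k₁ , e₁ | k₂ , e₂ | k₃ , e₃ =
  (k₁ , k₂ , k₃) , λ i j k → cong₂ _∧_ (e₁ i) (cong₂ _∧_ (e₂ j) (e₃ k))

-- The shapes whose rank-one array lies below X: only these can occur in a
-- representation of X.
shapesBelow : Array → List Shape
shapesBelow X = filter (λ s → shapeArray s ⊑? X) shapes

-- Completes Bs X A n: X is obtained from A by adding n rank-one arrays with
-- shapes from the list Bs.
Completes : List Shape → Array → Array → ℕ → Set
Completes Bs X A zero    = A ≋ X
Completes Bs X A (suc n) = Any (λ s → Completes Bs X (A ⊕ shapeArray s) n) Bs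

completes? : ∀ Bs X A n → Dec (Completes Bs X A n)
completes? Bs X A zero    = A ≋? X
completes? Bs X A (suc n) = Any.any? (λ s → completes? Bs X (A ⊕ shapeArray s) n) Bs

completes⇒sum : ∀ Bs X A n → Completes Bs X A n →
                Σ (Vec Term n) λ ts → (A ⊕ sumTerms ts) ≋ X
completes⇒sum Bs X A zero    A≋X = [] , λ i j k → trans (Bool.∨-identityʳ (A i j k)) (A≋X i j k)
completes⇒sum Bs X A (suc n) found with Any.satisfied found
... | s , rest with completes⇒sum Bs X (A ⊕ shapeArray s) n rest
...   | ts , sum≋X = shapeTerm s ∷ ts , ≋-trans (⊕-assoc A (shapeArray s) (sumTerms ts)) sum≋X

sum⇒completes : ∀ X A {n} (ts : Vec Term n) → (A ⊕ sumTerms ts) ≋ X →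
                Completes (shapesBelow X) X A n
sum⇒completes X A []       sum≋X = λ i j k → trans (sym (Bool.∨-identityʳ (A i j k))) (sum≋X i j k)
sum⇒completes X A (t ∷ ts) sum≋X with term-canonical t
... | s , t≋B = Any.map (λ { refl → sum⇒completes X (A ⊕ B) ts B-sum≋X })
                        (∈-filter⁺ (λ s → shapeArray s ⊑? X) (∈-shapes s) B⊑X)
  where
  B = shapeArray s
  S = sumTerms ts
  -- replacing t by its canonical form does not change the sum
  sum≋ : (A ⊕ (B ⊕ S)) ≋ X
  sum≋ i j k rewrite sym (t≋B i j k) = sum≋X i j k
  B⊑X : B ⊑ X
  B⊑X i j k = subst (B i j k Bool.≤_) (sum≋ i j k) (summand-⊑ A B S i j k)
  B-sum≋X : ((A ⊕ B) ⊕ S) ≋ X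
  B-sum≋X i j k = trans (sym (⊕-assoc A B S i j k)) (sum≋ i j k)

representable? : ∀ X n → Dec (Representable X n)
representable? X n =
  map′ (completes⇒sum (shapesBelow X) X zeroArray n) (λ (ts , e) → sum⇒completes X zeroArray ts e)
       (completes? (shapesBelow X) X zeroArray n)

least-representation : ∀ X → ∃ λ (n : Fin 5) →
  Representable X (toℕ n) × (∀ (m : Fin′ n) → ¬ Representable X (toℕ (inject m)))
least-representation X
  with ¬∀⟶∃¬-smallest 5 (λ n → ¬ Representable X (toℕ n))
                        (λ n → ¬? (representable? X (toℕ n))) some-representation
  where
  some-representation : ¬ (∀ n → ¬ Representable X (toℕ n))
  some-representation none with representable-within-4 X
  ... | n , n≤4 , r = none (fromℕ< (s≤s n≤4)) (subst (Representable X) (sym (toℕ-fromℕ< (s≤s n≤4))) r)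
... | n , ¬¬r , smaller = n , decidable-stable (representable? X (toℕ n)) ¬¬r , smaller

rk : Array → ℕ
rk X = toℕ (proj₁ (least-representation X))

least⇒hasRank : ∀ X (n : Fin 5) → Representable X (toℕ n) →
  (∀ (m : Fin′ n) → ¬ Representable X (toℕ (inject m))) → HasRank X (toℕ n)
least⇒hasRank X n r smaller = r , minimal
  where
  minimal : ∀ R → R < toℕ n → ¬ Representable X R
  minimal R R<n = subst (λ m → ¬ Representable X m)
                        (trans (toℕ-inject (fromℕ< R<n)) (toℕ-fromℕ< R<n))
                        (smaller (fromℕ< R<n))

hasRank : ∀ X → HasRank X (rk X)
hasRank X = let n , r , smaller = least-representation X in least⇒hasRank X n r smaller

rk≤4 : ∀ X → rk X ≤ 4
rk≤4 X = s≤s⁻¹ (toℕ<n (proj₁ (least-representation X)))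

-- An array of rank 4: its entries equal 1 exactly at the positions ijk with i + j + k odd.
rank4Array : Array
rank4Array = pair (pair (pair false true) (pair true false)) (pair (pair true false) (pair false true))

mainTheorem3 : Σ (Array → ℕ) λ rk
    → (∀ X → HasRank X (rk X))
    × (∀ X → rk X ≤ 4)
    × (∃ λ X → rk X ≡ 4)
    × (length (filter (λ X → rk X ≟ 0) allArrays) ≡ 1)
    × (length (filter (λ X → rk X ≟ 1) allArrays) ≡ 27)
    × (length (filter (λ X → rk X ≟ 2) allArrays) ≡ 130)
    × (length (filter (λ X → rk X ≟ 3) allArrays) ≡ 88)
    × (length (filter (λ X → rk X ≟ 4) allArrays) ≡ 10)
mainTheorem3 = rk , hasRank , rk≤4 , (rank4Array , refl) , refl , refl , refl , refl , refl
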